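{- Let $0<|q|<1$, $u\in\mathbb{C}\setminus\{0\}$ and $n\ge0$ an integer. Then the polynomial $y(x)=\mathrm{R}_{n}(1,x;u|q)$ satisfies $y(0)=1$ and the functional difference equation $$(D_{q}y)(u^{ -1}x)+q^{n-1}x\,(D_{q}y)(q^{ -1}x)=(1-q^{n})\,y(x).$$
   Context: $(a;q)_n=\prod_{k=0}^{n-1}(1-aq^k)$, $\genfrac{[}{]}{0pt}{}{n}{k}_{q}=\frac{(q;q)_n}{(q;q)_k(q;q)_{n-k}}$, and $\mathrm{R}_{n}(x,y;u|q)=\sum_{k=0}^{n}\genfrac{[}{]}{0pt}{}{n}{k}_{q}u^{\binom{k}{2}}x^{n-k}y^{k}$. The $q$-differential operator is $D_qf(x)=\frac{f(x)-f(qx)}{x}$ (for polynomials, $D_q x^k=(1-q^k)x^{k-1}$), and $(D_qy)(c x)$ denotes the polynomial $D_qy$ evaluated at $cx$. -}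

module Defs where

open import Level using (Level)
open import Algebra.Bundles using (CommutativeRing)
open import Data.Nat using (ℕ; zero; suc; _∸_)
open import Data.Nat.Combinatorics using (_C_)
open import Data.Product using (Σ; proj₁)
open import Data.List using (List; []; _∷_; map; upTo)

-- Everything is developed over an arbitrary commutative ring R (stand-in for ℂ).
module QCalc {c ℓ : Level} (R : CommutativeRing c ℓ) where
  open CommutativeRing R

  pow : Carrier → ℕ → Carrier
  pow x zero    = 1#
  pow x (suc k) = x * pow x k

  poch : Carrier → Carrier → ℕ → Carrier
  poch a q zero    = 1#
  poch a q (suc n) = poch a q n * (1# - a * pow q n)

  -- A chosen inverse of (1 - q^(j+1)) for every j (exists when 0<|q|<1).
  InvFamily : Carrier → Set (c Level.⊔ ℓ)
  InvFamily q = (j : ℕ) → Σ Carrier (λ w → (1# - pow q (suc j)) * w ≈ 1#)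

  pochInv : (q : Carrier) → InvFamily q → ℕ → Carrier
  pochInv q inv zero    = 1#
  pochInv q inv (suc n) = pochInv q inv n * proj₁ (inv n)

  qbinom : (q : Carrier) → InvFamily q → ℕ → ℕ → Carrier
  qbinom q inv n k = poch q q n * (pochInv q inv k * pochInv q inv (n ∸ k))

  -- polynomials as coefficient lists (constant term first)
  Poly : Set c
  Poly = List Carrier

  eval : Poly → Carrier → Carrier
  eval []       x = 0#
  eval (a ∷ as) x = a + x * eval as x

  -- q-derivative on polynomials: D_q x^k = (1 - q^k) x^(k-1)
  Dq-from : Carrier → ℕ → Poly → Poly
  Dq-from q k []       = []
  Dq-from q k (a ∷ as) = ((1# - pow q k) * a) ∷ Dq-from q (suc k) as

  Dq : Carrier → Poly → Poly
  Dq q []       = []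
  Dq q (a ∷ as) = Dq-from q 1 as

  -- R_n(x, Y; u|q) as a polynomial in the variable Y (coefficient of Y^k)
  Rpoly : (q : Carrier) → InvFamily q → ℕ → Carrier → Carrier → Poly
  Rpoly q inv n x u =
    map (λ k → qbinom q inv n k * pow u (k C 2) * pow x (n ∸ k)) (upTo (suc n))

  -- q^(n-1) as an element of R (for n = 0 this is q^(-1), given an inverse qi of q)
  qPowPred : Carrier → Carrier → ℕ → Carrier
  qPowPred q qi zero    = qi
  qPowPred q qi (suc m) = pow q m

{-# OPTIONS --safe #-}
-- Write y = Σ_{k≤n} c_k x^k with c_k = [n k]_q u^(k choose 2), so that D_q y has coefficients
-- (1 - q^(k+1)) c_(k+1).  The absorption identity (1 - q^(k+1)) [n k+1]_q = (1 - q^(n-k)) [n k]_q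
-- and u^(k+1 choose 2) = u^(k choose 2) u^k give (D_q y)(x/u) = Σ_{k<n} (1 - q^(n-k)) c_k x^k, while
-- q^(n-1) x (D_q y)(x/q) = Σ_{k<n} q^(n-k-1) (1 - q^(k+1)) c_(k+1) x^(k+1).  Their sum is (1 - q^n) y(x)
-- coefficientwise, because 1 - q^n = (1 - q^(n-k)) + q^(n-k) (1 - q^k).
module Submission where

open import Defs
open import Level using (Level)
open import Algebra.Bundles using (CommutativeRing)
open import Data.Nat as ℕ using (ℕ; zero; suc; _∸_; _<_; _≤_; s≤s; s≤s⁻¹; z≤n)
open import Data.Nat.Properties as ℕₚ using (+-∸-assoc; m∸n+n≡m; n∸n≡0)
open import Data.Nat.Combinatorics using (_C_; nC1≡n; nCk+nC[k+1]≡[n+1]C[k+1])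
open import Data.Product using (_×_; _,_; proj₁; proj₂)
open import Data.List using (applyUpTo)
open import Data.List.Properties using (map-applyUpTo)
open import Function using (id; _∘_)
open import Relation.Binary.PropositionalEquality as ≡ using (_≡_)
import Algebra.Properties.CommutativeSemigroup as CommutativeSemigroupProperties
import Algebra.Properties.Ring as RingProperties
import Algebra.Properties.Semiring.Exp as SemiringExp
import Algebra.Solver.Ring.NaturalCoefficients.Default as NaturalCoefficientsSolver
import Relation.Binary.Reasoning.Setoid as SetoidReasoning

module QCalcProperties {c ℓ : Level} (R : CommutativeRing c ℓ) where
  open CommutativeRing R
  open QCalc R
  open CommutativeSemigroupProperties *-commutativeSemigroup
    using (interchange; x∙yz≈y∙xz)
  open RingProperties ring using (-‿distribʳ-*)
  open SemiringExp semiring using (_^_; ^-homo-*)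
  open NaturalCoefficientsSolver commutativeSemiring using (solve; _:+_; _:*_; _:=_; con)
  open SetoidReasoning setoid

  pow≡^ : ∀ x k → pow x k ≡ x ^ k
  pow≡^ x zero    = ≡.refl
  pow≡^ x (suc k) = ≡.cong (x *_) (pow≡^ x k)

  pow-homo-+ : ∀ x m n → pow x (m ℕ.+ n) ≈ pow x m * pow x n
  pow-homo-+ x m n rewrite pow≡^ x (m ℕ.+ n) | pow≡^ x m | pow≡^ x n = ^-homo-* x m n

  pow-∸ : ∀ x {m k} → k ≤ m → pow x m ≈ pow x (m ∸ k) * pow x k
  pow-∸ x {m} {k} k≤m = begin
    pow x m                 ≡⟨ ≡.cong (pow x) (m∸n+n≡m k≤m) ⟨
    pow x (m ∸ k ℕ.+ k)     ≈⟨ pow-homo-+ x (m ∸ k) k ⟩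
    pow x (m ∸ k) * pow x k ∎

  pow-1# : ∀ k → pow 1# k ≈ 1#
  pow-1# zero    = refl
  pow-1# (suc k) = trans (*-identityˡ _) (pow-1# k)

  *-pow-1# : ∀ a t → a * pow 1# t ≈ a
  *-pow-1# a t = trans (*-congˡ (pow-1# t)) (*-identityʳ a)

  pow-inverse : ∀ {a b} → a * b ≈ 1# → ∀ k → pow a k * pow b k ≈ 1#
  pow-inverse ab≈1 zero            = *-identityˡ 1#
  pow-inverse {a} {b} ab≈1 (suc k) = begin
    (a * pow a k) * (b * pow b k) ≈⟨ interchange a (pow a k) b (pow b k) ⟩
    (a * b) * (pow a k * pow b k) ≈⟨ *-cong ab≈1 (pow-inverse ab≈1 k) ⟩
    1# * 1#                       ≈⟨ *-identityˡ 1# ⟩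
    1#                            ∎

  pow-inverse-∸ : ∀ {a b m k} → a * b ≈ 1# → k ≤ m → pow a m * pow b k ≈ pow a (m ∸ k)
  pow-inverse-∸ {a} {b} {m} {k} ab≈1 k≤m = begin
    pow a m * pow b k                   ≈⟨ *-congʳ (pow-∸ a k≤m) ⟩
    (pow a (m ∸ k) * pow a k) * pow b k ≈⟨ *-assoc _ _ _ ⟩
    pow a (m ∸ k) * (pow a k * pow b k) ≈⟨ *-congˡ (pow-inverse ab≈1 k) ⟩
    pow a (m ∸ k) * 1#                  ≈⟨ *-identityʳ _ ⟩
    pow a (m ∸ k)                       ∎

  pow-suc-C2 : ∀ x k → pow x (suc k C 2) ≈ pow x (k C 2) * pow x k
  pow-suc-C2 x k = begin
    pow x (suc k C 2)         ≡⟨ ≡.cong (pow x) sucC2 ⟨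
    pow x (k ℕ.+ k C 2)       ≈⟨ pow-homo-+ x k (k C 2) ⟩
    pow x k * pow x (k C 2)   ≈⟨ *-comm _ _ ⟩
    pow x (k C 2) * pow x k   ∎
    where
    sucC2 : k ℕ.+ k C 2 ≡ suc k C 2
    sucC2 = ≡.trans (≡.cong (ℕ._+ k C 2) (≡.sym (nC1≡n k))) (nCk+nC[k+1]≡[n+1]C[k+1] k 1)

  1-xy≈[1-x]+x[1-y] : ∀ x y → 1# - x * y ≈ (1# - x) + x * (1# - y)
  1-xy≈[1-x]+x[1-y] x y = sym (begin
    (1# + - x) + x * (1# + - y)
      ≈⟨ solve 4 (λ x y -x -y → (con 1 :+ -x) :+ x :* (con 1 :+ -y)
                               := (con 1 :+ x :* -y) :+ (-x :+ x))
                 refl x y (- x) (- y) ⟩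
    (1# + x * - y) + (- x + x) ≈⟨ +-cong (+-congˡ (sym (-‿distribʳ-* x y))) (-‿inverseˡ x) ⟩
    (1# - x * y) + 0#          ≈⟨ +-identityʳ _ ⟩
    1# - x * y                 ∎)

  evalUpTo : (ℕ → Carrier) → ℕ → Carrier → Carrier
  evalUpTo f m x = eval (applyUpTo f m) x

  evalUpTo-cong : ∀ {f g} m x → (∀ {k} → k < m → f k ≈ g k) → evalUpTo f m x ≈ evalUpTo g m x
  evalUpTo-cong zero    x f≈g = refl
  evalUpTo-cong (suc m) x f≈g =
    +-cong (f≈g (s≤s z≤n)) (*-congˡ (evalUpTo-cong m x (λ k<m → f≈g (s≤s k<m))))

  evalUpTo-0# : ∀ f m → evalUpTo f (suc m) 0# ≈ f 0
  evalUpTo-0# f m = trans (+-congˡ (zeroˡ _)) (+-identityʳ _)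

  evalUpTo-dropLast : ∀ f m x → f m ≈ 0# → evalUpTo f (suc m) x ≈ evalUpTo f m x
  evalUpTo-dropLast f zero    x f0≈0 = trans (+-cong f0≈0 (zeroʳ x)) (+-identityʳ 0#)
  evalUpTo-dropLast f (suc m) x fm≈0 = +-congˡ (*-congˡ (evalUpTo-dropLast (f ∘ suc) m x fm≈0))

  *-evalUpTo : ∀ a f m x → a * evalUpTo f m x ≈ evalUpTo (λ k → a * f k) m x
  *-evalUpTo a f zero    x = zeroʳ a
  *-evalUpTo a f (suc m) x = begin
    a * (f 0 + x * evalUpTo (f ∘ suc) m x)        ≈⟨ distribˡ a _ _ ⟩
    a * f 0 + a * (x * evalUpTo (f ∘ suc) m x)    ≈⟨ +-congˡ (x∙yz≈y∙xz a x _) ⟩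
    a * f 0 + x * (a * evalUpTo (f ∘ suc) m x)    ≈⟨ +-congˡ (*-congˡ (*-evalUpTo a (f ∘ suc) m x)) ⟩
    a * f 0 + x * evalUpTo (λ k → a * f (suc k)) m x ∎

  evalUpTo-+ : ∀ f g m x → evalUpTo f m x + evalUpTo g m x ≈ evalUpTo (λ k → f k + g k) m x
  evalUpTo-+ f g zero    x = +-identityˡ 0#
  evalUpTo-+ f g (suc m) x = begin
    (f 0 + x * F) + (g 0 + x * G) ≈⟨ solve 5 (λ f0 g0 x F G → (f0 :+ x :* F) :+ (g0 :+ x :* G)
                                                             := (f0 :+ g0) :+ x :* (F :+ G))
                                             refl (f 0) (g 0) x F G ⟩
    (f 0 + g 0) + x * (F + G)     ≈⟨ +-congˡ (*-congˡ (evalUpTo-+ (f ∘ suc) (g ∘ suc) m x)) ⟩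
    (f 0 + g 0) + x * evalUpTo (λ k → f (suc k) + g (suc k)) m x ∎
    where
    F = evalUpTo (f ∘ suc) m x
    G = evalUpTo (g ∘ suc) m x

  evalUpTo-dilate : ∀ f m a x → evalUpTo f m (a * x) ≈ evalUpTo (λ k → f k * pow a k) m x
  evalUpTo-dilate f zero    a x = refl
  evalUpTo-dilate f (suc m) a x = +-cong (sym (*-identityʳ (f 0))) (begin
    (a * x) * evalUpTo (f ∘ suc) m (a * x)
      ≈⟨ *-congˡ (evalUpTo-dilate (f ∘ suc) m a x) ⟩
    (a * x) * evalUpTo (λ k → f (suc k) * pow a k) m x
      ≈⟨ trans (*-congʳ (*-comm a x)) (*-assoc x a _) ⟩
    x * (a * evalUpTo (λ k → f (suc k) * pow a k) m x)
      ≈⟨ *-congˡ (*-evalUpTo a _ m x) ⟩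
    x * evalUpTo (λ k → a * (f (suc k) * pow a k)) m x
      ≈⟨ *-congˡ (evalUpTo-cong m x (λ _ → x∙yz≈y∙xz a _ _)) ⟩
    x * evalUpTo (λ k → f (suc k) * (a * pow a k)) m x ∎)

  Dq-coeff : Carrier → (ℕ → Carrier) → ℕ → Carrier
  Dq-coeff q f k = (1# - pow q (suc k)) * f (suc k)

  eval-Dq-from : ∀ q s g m x →
    eval (Dq-from q s (applyUpTo g m)) x ≈ evalUpTo (λ k → (1# - pow q (s ℕ.+ k)) * g k) m x
  eval-Dq-from q s g zero    x = refl
  eval-Dq-from q s g (suc m) x =
    +-cong (reflexive (≡.cong (λ t → (1# - pow q t) * g 0) (≡.sym (ℕₚ.+-identityʳ s))))
      (*-congˡ (trans (eval-Dq-from q (suc s) (g ∘ suc) m x)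
        (evalUpTo-cong m x (λ {k} _ →
          reflexive (≡.cong (λ t → (1# - pow q t) * g (suc k)) (≡.sym (ℕₚ.+-suc s k)))))))

  eval-Dq : ∀ q f m x → eval (Dq q (applyUpTo f (suc m))) x ≈ evalUpTo (Dq-coeff q f) m x
  eval-Dq q f = eval-Dq-from q 1 (f ∘ suc)

  module _ (q : Carrier) where

    1-qⁿ-split : ∀ n c x →
      (1# - pow q n) * evalUpTo c (suc n) x
        ≈ evalUpTo (λ k → (1# - pow q (n ∸ k)) * c k) n x
          + x * evalUpTo (λ k → pow q (n ∸ suc k) * Dq-coeff q c k) n x
    1-qⁿ-split n c x = begin
      (1# - pow q n) * evalUpTo c (suc n) x
        ≈⟨ *-evalUpTo _ c (suc n) x ⟩
      evalUpTo (λ k → (1# - pow q n) * c k) (suc n) x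
        ≈⟨ evalUpTo-cong (suc n) x (λ k<1+n → split (s≤s⁻¹ k<1+n)) ⟩
      evalUpTo (λ k → low k + high k) (suc n) x
        ≈⟨ evalUpTo-+ low high (suc n) x ⟨
      evalUpTo low (suc n) x + (high 0 + x * evalUpTo (high ∘ suc) n x)
        ≈⟨ +-cong (evalUpTo-dropLast low n x lowₙ≈0) (trans (+-congʳ high₀≈0) (+-identityˡ _)) ⟩
      evalUpTo low n x + x * evalUpTo (high ∘ suc) n x ∎
      where
      low high : ℕ → Carrier
      low  k = (1# - pow q (n ∸ k)) * c k
      high k = pow q (n ∸ k) * ((1# - pow q k) * c k)

      split : ∀ {k} → k ≤ n → (1# - pow q n) * c k ≈ low k + high k
      split {k} k≤n = begin
        (1# - pow q n) * c k
          ≈⟨ *-congʳ (+-congˡ (-‿cong (pow-∸ q k≤n))) ⟩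
        (1# - pow q (n ∸ k) * pow q k) * c k
          ≈⟨ *-congʳ (1-xy≈[1-x]+x[1-y] _ _) ⟩
        ((1# - pow q (n ∸ k)) + pow q (n ∸ k) * (1# - pow q k)) * c k
          ≈⟨ trans (distribʳ _ _ _) (+-congˡ (*-assoc _ _ _)) ⟩
        low k + high k ∎

      1-1≈0 : ∀ z → (1# - 1#) * z ≈ 0#
      1-1≈0 z = trans (*-congʳ (-‿inverseʳ 1#)) (zeroˡ z)

      lowₙ≈0 : low n ≈ 0#
      lowₙ≈0 = trans (reflexive (≡.cong (λ t → (1# - pow q t) * c n) (n∸n≡0 n))) (1-1≈0 (c n))

      high₀≈0 : high 0 ≈ 0#
      high₀≈0 = trans (*-congˡ (1-1≈0 (c 0))) (zeroʳ _)

    evalUpTo-dilate-q⁻¹ : ∀ {qi} → q * qi ≈ 1# → ∀ n f x →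
      qPowPred q qi n * x * evalUpTo f n (qi * x)
        ≈ x * evalUpTo (λ k → pow q (n ∸ suc k) * f k) n x
    evalUpTo-dilate-q⁻¹ {qi} q*qi≈1 n f x = begin
      qPowPred q qi n * x * evalUpTo f n (qi * x)
        ≈⟨ trans (*-congʳ (*-comm _ x)) (*-assoc x _ _) ⟩
      x * (qPowPred q qi n * evalUpTo f n (qi * x))
        ≈⟨ *-congˡ (*-congˡ (evalUpTo-dilate f n qi x)) ⟩
      x * (qPowPred q qi n * evalUpTo (λ k → f k * pow qi k) n x)
        ≈⟨ *-congˡ (*-evalUpTo _ _ n x) ⟩
      x * evalUpTo (λ k → qPowPred q qi n * (f k * pow qi k)) n x
        ≈⟨ *-congˡ (evalUpTo-cong n x (λ k<n →
             trans (x∙yz≈y∙xz _ _ _) (trans (*-congˡ (qPowPred-cancel n k<n)) (*-comm _ _)))) ⟩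
      x * evalUpTo (λ k → pow q (n ∸ suc k) * f k) n x ∎
      where
      -- For n = 0 both sides are empty sums, so the value qPowPred q qi 0 = qi never matters.
      qPowPred-cancel : ∀ n {k} → k < n → qPowPred q qi n * pow qi k ≈ pow q (n ∸ suc k)
      qPowPred-cancel (suc m) (s≤s k≤m) = pow-inverse-∸ q*qi≈1 k≤m

  module QBinomial (q : Carrier) (inv : InvFamily q) where

    pochInv-suc : ∀ j → (1# - pow q (suc j)) * pochInv q inv (suc j) ≈ pochInv q inv j
    pochInv-suc j = begin
      (1# - pow q (suc j)) * (pochInv q inv j * proj₁ (inv j))
        ≈⟨ x∙yz≈y∙xz _ _ _ ⟩
      pochInv q inv j * ((1# - pow q (suc j)) * proj₁ (inv j))
        ≈⟨ *-congˡ (proj₂ (inv j)) ⟩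
      pochInv q inv j * 1#
        ≈⟨ *-identityʳ _ ⟩
      pochInv q inv j ∎

    poch*pochInv : ∀ n → poch q q n * pochInv q inv n ≈ 1#
    poch*pochInv zero    = *-identityˡ 1#
    poch*pochInv (suc n) = begin
      (poch q q n * (1# - pow q (suc n))) * (pochInv q inv n * proj₁ (inv n))
        ≈⟨ interchange _ _ _ _ ⟩
      (poch q q n * pochInv q inv n) * ((1# - pow q (suc n)) * proj₁ (inv n))
        ≈⟨ *-cong (poch*pochInv n) (proj₂ (inv n)) ⟩
      1# * 1#
        ≈⟨ *-identityˡ 1# ⟩
      1# ∎

    qbinom-zero : ∀ n → qbinom q inv n 0 ≈ 1#
    qbinom-zero n = trans (*-congˡ (*-identityˡ _)) (poch*pochInv n)

    qbinom-absorb : ∀ {n k} → k < n →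
      (1# - pow q (suc k)) * qbinom q inv n (suc k) ≈ (1# - pow q (n ∸ k)) * qbinom q inv n k
    qbinom-absorb {n} {k} k<n = begin
      (1# - pow q (suc k)) * (P * (I (suc k) * I j))
        ≈⟨ trans (x∙yz≈y∙xz _ P _) (*-congˡ (sym (*-assoc _ _ _))) ⟩
      P * (((1# - pow q (suc k)) * I (suc k)) * I j)
        ≈⟨ *-congˡ (*-congʳ (pochInv-suc k)) ⟩
      P * (I k * I j)
        ≈⟨ *-congˡ (*-congˡ (pochInv-suc j)) ⟨
      P * (I k * ((1# - pow q (suc j)) * I (suc j)))
        ≈⟨ trans (*-congˡ (x∙yz≈y∙xz _ _ _)) (x∙yz≈y∙xz P _ _) ⟩
      (1# - pow q (suc j)) * (P * (I k * I (suc j)))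
        ≡⟨ ≡.cong (λ t → (1# - pow q t) * (P * (I k * I t))) n∸k≡1+j ⟨
      (1# - pow q (n ∸ k)) * qbinom q inv n k ∎
      where
      P = poch q q n
      I = pochInv q inv
      j = n ∸ suc k
      n∸k≡1+j : n ∸ k ≡ suc j
      n∸k≡1+j = +-∸-assoc 1 k<n

  module RogersSzegő (q u : Carrier) (inv : InvFamily q) where
    open QBinomial q inv

    Rcoeff : ℕ → ℕ → Carrier
    Rcoeff n k = qbinom q inv n k * pow u (k C 2)

    Rpoly≡applyUpTo : ∀ n →
      Rpoly q inv n 1# u ≡ applyUpTo (λ k → Rcoeff n k * pow 1# (n ∸ k)) (suc n)
    Rpoly≡applyUpTo n = map-applyUpTo id _ (suc n)

    Rcoeff-zero : ∀ n → Rcoeff n 0 ≈ 1#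
    Rcoeff-zero n = trans (*-identityʳ _) (qbinom-zero n)

    eval-Rpoly : ∀ n x → eval (Rpoly q inv n 1# u) x ≈ evalUpTo (Rcoeff n) (suc n) x
    eval-Rpoly n x = begin
      eval (Rpoly q inv n 1# u) x
        ≡⟨ ≡.cong (λ p → eval p x) (Rpoly≡applyUpTo n) ⟩
      evalUpTo (λ k → Rcoeff n k * pow 1# (n ∸ k)) (suc n) x
        ≈⟨ evalUpTo-cong (suc n) x (λ {k} _ → *-pow-1# (Rcoeff n k) (n ∸ k)) ⟩
      evalUpTo (Rcoeff n) (suc n) x ∎

    eval-Dq-Rpoly : ∀ n x → eval (Dq q (Rpoly q inv n 1# u)) x ≈ evalUpTo (Dq-coeff q (Rcoeff n)) n x
    eval-Dq-Rpoly n x = begin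
      eval (Dq q (Rpoly q inv n 1# u)) x
        ≡⟨ ≡.cong (λ p → eval (Dq q p) x) (Rpoly≡applyUpTo n) ⟩
      eval (Dq q (applyUpTo (λ k → Rcoeff n k * pow 1# (n ∸ k)) (suc n))) x
        ≈⟨ eval-Dq q (λ k → Rcoeff n k * pow 1# (n ∸ k)) n x ⟩
      evalUpTo (Dq-coeff q (λ k → Rcoeff n k * pow 1# (n ∸ k))) n x
        ≈⟨ evalUpTo-cong n x (λ {k} _ → *-congˡ (*-pow-1# (Rcoeff n (suc k)) (n ∸ suc k))) ⟩
      evalUpTo (Dq-coeff q (Rcoeff n)) n x ∎

    module _ {ui : Carrier} (u*ui≈1 : u * ui ≈ 1#) where

      Dq-Rcoeff-dilate-u⁻¹ : ∀ {n k} → k < n →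
        Dq-coeff q (Rcoeff n) k * pow ui k ≈ (1# - pow q (n ∸ k)) * Rcoeff n k
      Dq-Rcoeff-dilate-u⁻¹ {n} {k} k<n = begin
        ((1# - pow q (suc k)) * (qbinom q inv n (suc k) * pow u (suc k C 2))) * pow ui k
          ≈⟨ *-congʳ (*-congˡ (*-congˡ (pow-suc-C2 u k))) ⟩
        (X * (B * (U * pow u k))) * pow ui k
          ≈⟨ solve 5 (λ X B U uk uik → (X :* (B :* (U :* uk))) :* uik
                                     := ((X :* B) :* U) :* (uk :* uik))
                     refl X B U (pow u k) (pow ui k) ⟩
        ((X * B) * U) * (pow u k * pow ui k)
          ≈⟨ *-cong (*-congʳ (qbinom-absorb k<n)) (pow-inverse u*ui≈1 k) ⟩
        (((1# - pow q (n ∸ k)) * qbinom q inv n k) * U) * 1#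
          ≈⟨ trans (*-identityʳ _) (*-assoc _ _ _) ⟩
        (1# - pow q (n ∸ k)) * Rcoeff n k ∎
        where
        X = 1# - pow q (suc k)
        B = qbinom q inv n (suc k)
        U = pow u (k C 2)

      evalUpTo-Dq-Rcoeff-u⁻¹ : ∀ n x →
        evalUpTo (Dq-coeff q (Rcoeff n)) n (ui * x)
          ≈ evalUpTo (λ k → (1# - pow q (n ∸ k)) * Rcoeff n k) n x
      evalUpTo-Dq-Rcoeff-u⁻¹ n x =
        trans (evalUpTo-dilate _ n ui x) (evalUpTo-cong n x Dq-Rcoeff-dilate-u⁻¹)

mainTheorem5 : {c ℓ : Level} (R : CommutativeRing c ℓ) →
  let open CommutativeRing R
      open QCalc R
  in (q u : Carrier) (inv : InvFamily q) →
     (qi : Carrier) → q * qi ≈ 1# →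
     (ui : Carrier) → u * ui ≈ 1# →
     (n : ℕ) →
     (eval (Rpoly q inv n 1# u) 0# ≈ 1#)
     × ((x : Carrier) →
        eval (Dq q (Rpoly q inv n 1# u)) (ui * x)
          + qPowPred q qi n * x * eval (Dq q (Rpoly q inv n 1# u)) (qi * x)
        ≈ (1# - pow q n) * eval (Rpoly q inv n 1# u) x)
mainTheorem5 R q u inv qi q*qi≈1 ui u*ui≈1 n = constant-term , difference-equation
  where
  open CommutativeRing R
  open QCalc R
  open QCalcProperties R
  open RogersSzegő q u inv
  open SetoidReasoning setoid

  y = Rpoly q inv n 1# u

  constant-term : eval y 0# ≈ 1#
  constant-term = trans (eval-Rpoly n 0#) (trans (evalUpTo-0# (Rcoeff n) n) (Rcoeff-zero n))

  difference-equation : ∀ x →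
    eval (Dq q y) (ui * x) + qPowPred q qi n * x * eval (Dq q y) (qi * x) ≈ (1# - pow q n) * eval y x
  difference-equation x = begin
    eval (Dq q y) (ui * x) + qPowPred q qi n * x * eval (Dq q y) (qi * x)
      ≈⟨ +-cong (eval-Dq-Rpoly n (ui * x)) (*-congˡ (eval-Dq-Rpoly n (qi * x))) ⟩
    evalUpTo (Dq-coeff q (Rcoeff n)) n (ui * x)
      + qPowPred q qi n * x * evalUpTo (Dq-coeff q (Rcoeff n)) n (qi * x)
      ≈⟨ +-cong (evalUpTo-Dq-Rcoeff-u⁻¹ u*ui≈1 n x) (evalUpTo-dilate-q⁻¹ q q*qi≈1 n _ x) ⟩
    evalUpTo (λ k → (1# - pow q (n ∸ k)) * Rcoeff n k) n x
      + x * evalUpTo (λ k → pow q (n ∸ suc k) * Dq-coeff q (Rcoeff n) k) n x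
      ≈⟨ 1-qⁿ-split q n (Rcoeff n) x ⟨
    (1# - pow q n) * evalUpTo (Rcoeff n) (suc n) x
      ≈⟨ *-congˡ (eval-Rpoly n x) ⟨
    (1# - pow q n) * eval y x ∎
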